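{- Let $n \ge k \ge 2$ be integers with $k \equiv 2$ or $3 \pmod 4$. Then \[ \mathbb{P}\big( G \sim \mathbb{G}(n,1/2) \text{ is a } k\text{ -Ramsey graph} \big) = (-1)^{\binom{n}{k}} \cdot P_{n,k}\!\left(\tfrac12\right). \]
   Context: $[n]=\{1,\dots,n\}$; $\binom{S}{j}$ is the set of $j$-element subsets of $S$. $\mathbb{G}(n,1/2)$ is the Erdős–Rényi random graph on vertex set $[n]$ with edge probability $1/2$ (i.e. a uniformly random graph on $[n]$). A graph is $k$-Ramsey if it contains no clique of size $k$ and no independent set of size $k$. Let $\mathcal{A}$ be the set of assignments $\mathfrak{g}$ which associate to each $S \in \binom{[n]}{k}$ a finite simple undirected graph $\mathfrak{g}_S$ on vertex set $S$ which is neither the complete graph $K_S$ nor the empty graph $\overline{K_S}$. For $\mathfrak{g}\in\mathcal{A}$, let $\mathrm{Edges}(\mathfrak{g}) := \bigcup_{S} \mathbf{E}(\mathfrak{g}_S) \subseteq \binom{[n]}{2}$ and $\mathrm{sign}(\mathfrak{g}) := \prod_{S} (-1)^{|\mathbf{E}(\mathfrak{g}_S)|}$. Define $P_{n,k}(t) := \sum_{\mathfrak{g}\in\mathcal{A}} \mathrm{sign}(\mathfrak{g})\, t^{|\mathrm{Edges}(\mathfrak{g})|} \in \mathbb{Z}[t]$. -}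

module Defs where

open import Data.Bool using (Bool; true; false; not; _∧_; _∨_; if_then_else_)
open import Data.Nat as ℕ using (ℕ; zero; suc)
open import Data.Fin using (Fin)
open import Data.Fin.Properties using () renaming (_≟_ to _≟ᶠ_)
open import Data.List using (List; []; _∷_; map; _++_; filter; length; foldr; allFin)
open import Data.Bool.ListAction using (all; any)
open import Data.Bool.Properties using (T?)
open import Data.List.Properties using (≡-dec)
open import Data.Rational using (ℚ; 0ℚ; 1ℚ; _+_; _*_; -_; ½)
open import Relation.Nullary using (does)

_^ℚ_ : ℚ → ℕ → ℚ
q ^ℚ zero  = 1ℚ
q ^ℚ suc m = q * (q ^ℚ m)

-1ℚ : ℚ
-1ℚ = - 1ℚ

sumℚ : List ℚ → ℚ
sumℚ = foldr _+_ 0ℚ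

prodℚ : List ℚ → ℚ
prodℚ = foldr _*_ 1ℚ

-- All sublists (subsequences) of a list: models all subsets of a finite set
sublists : {A : Set} → List A → List (List A)
sublists []       = [] ∷ []
sublists (x ∷ xs) = let r = sublists xs in map (x ∷_) r ++ r

-- All j-element sublists: models binom(S, j) for S given as a duplicate-free list
choose : {A : Set} → ℕ → List A → List (List A)
choose zero    _        = [] ∷ []
choose (suc j) []       = []
choose (suc j) (x ∷ xs) = map (x ∷_) (choose j xs) ++ choose (suc j) xs

-- Vertices [n] = Fin n; an edge is a 2-element subset {i,j} ⊆ [n],
-- represented as the increasing list (i ∷ j ∷ []) as produced by choose 2.
Edge : ℕ → Set
Edge n = List (Fin n)

-- A graph on vertex set V (listed without repetition) is an edge set,
-- i.e. a sublist of choose 2 V.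
EdgeSet : ℕ → Set
EdgeSet n = List (Edge n)

_∈ᵇ_ : {n : ℕ} → Edge n → EdgeSet n → Bool
_∈ᵇ_ {n} e E = any (λ f → does (≡-dec _≟ᶠ_ e f)) E

allEdges : (n : ℕ) → EdgeSet n
allEdges n = choose 2 (allFin n)

kSubsets : (n k : ℕ) → List (List (Fin n))
kSubsets n k = choose k (allFin n)

allGraphs : (n : ℕ) → List (EdgeSet n)
allGraphs n = sublists (allEdges n)

isClique : {n : ℕ} → EdgeSet n → List (Fin n) → Bool
isClique E S = all (λ e → e ∈ᵇ E) (choose 2 S)

isIndep : {n : ℕ} → EdgeSet n → List (Fin n) → Bool
isIndep E S = all (λ e → not (e ∈ᵇ E)) (choose 2 S)

isRamsey : (n k : ℕ) → EdgeSet n → Bool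
isRamsey n k E = not (any (λ S → isClique E S ∨ isIndep E S) (kSubsets n k))

-- P( G ~ G(n,1/2) is k-Ramsey ) = #{k-Ramsey graphs on [n]} * (1/2)^(n choose 2)
-- (each of the 2^(n choose 2) graphs on [n] has probability (1/2)^(n choose 2))
ramseyProb : (n k : ℕ) → ℚ
ramseyProb n k =
  sumℚ (map (λ E → if isRamsey n k E then ½ ^ℚ length (allEdges n) else 0ℚ) (allGraphs n))

admissible : {n : ℕ} → List (Fin n) → List (EdgeSet n)
admissible S = filter (λ E → T? (not (isClique E S) ∧ not (isIndep E S))) (sublists (choose 2 S))

-- Cartesian product of a list of lists: all choice functions
choices : {A : Set} → List (List A) → List (List A)
choices []         = [] ∷ []
choices (xs ∷ xss) = let r = choices xss in
  foldr (λ x acc → map (x ∷_) r ++ acc) [] xs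

-- The set A of assignments g: one admissible graph g_S for each S ∈ binom([n],k),
-- listed in the order of kSubsets n k.
assignments : (n k : ℕ) → List (List (EdgeSet n))
assignments n k = choices (map admissible (kSubsets n k))

numEdges : {n : ℕ} → List (EdgeSet n) → ℕ
numEdges {n} g = length (filter (λ e → T? (any (λ E → e ∈ᵇ E) g)) (allEdges n))

sign : {n : ℕ} → List (EdgeSet n) → ℚ
sign g = prodℚ (map (λ E → -1ℚ ^ℚ length E) g)

P : (n k : ℕ) → ℚ → ℚ
P n k t = sumℚ (map (λ g → sign g * (t ^ℚ numEdges g)) (assignments n k))

{-# OPTIONS --safe #-}
-- Write 2^{-|Edges(g)|} as the probability that a uniformly random graph G on [n] contains every
-- g_S. For fixed G the sum over assignments g then factorises over the k-sets S, each factor being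
-- the alternating sum of (-1)^{|F|} [F ⊆ G] over the graphs F on S that are neither complete nor
-- empty. Over all graphs F on S this sum is [S is independent in G]; the empty graph contributes 1
-- and the complete one (-1)^{binom(k,2)} [S is a clique in G] = -[S is a clique in G], because
-- k ≡ 2, 3 (mod 4). So each factor is -[S is neither a clique nor independent in G], their product
-- is (-1)^{binom(n,k)} [G is k-Ramsey], and averaging over G gives the theorem.
module Submission where

open import Defs
open import Data.Nat using (ℕ; _≤_; _%_)
open import Data.Nat.Combinatorics using (_C_)
open import Data.Rational using (½; _*_)
open import Data.Sum using (_⊎_)
open import Relation.Binary.PropositionalEquality using (_≡_)

open import Data.Bool using (Bool; true; false; not; _∧_; _∨_; if_then_else_; T)
open import Data.Bool.ListAction using (all; any)
open import Data.Bool.Properties using (T?; T-≡; ∧-zeroʳ; ∨-zeroʳ; ∨-identityʳ)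
open import Data.Empty using (⊥-elim)
open import Data.Fin using (Fin)
open import Data.Fin.Properties using () renaming (_≟_ to _≟ᶠ_)
open import Data.List using (List; []; _∷_; map; _++_; filter; length; foldr; allFin)
open import Data.List.Membership.Propositional using (_∈_; _∉_; find; lose)
open import Data.List.Membership.Propositional.Properties using (∈-map⁻; ∈-map⁺; ∈-++⁻; ∈-++⁺ˡ; ∈-++⁺ʳ; ∈-filter⁻)
open import Data.List.Properties using (≡-dec; map-cong-local; map-∘; length-++; length-map; length-tabulate)
open import Data.List.Relation.Binary.Sublist.Propositional using (_⊆_; []; _∷_; _∷ʳ_; minimum; ⊆-trans; lookup)
open import Data.List.Relation.Binary.Sublist.Propositional.Properties using (All-resp-⊆)
import Data.List.Relation.Unary.All as All
open All using ([]; _∷_)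
open import Data.List.Relation.Unary.All.Properties using (all⁺; all⁻)
open import Data.List.Relation.Unary.AllPairs using ([]; _∷_)
open import Data.List.Relation.Unary.Any using (here; there)
open import Data.List.Relation.Unary.Any.Properties using (any⁺; any⁻)
open import Data.List.Relation.Unary.Unique.Propositional using (Unique)
import Data.List.Relation.Unary.Unique.Propositional.Properties as Unique
open import Data.Nat as ℕ using (zero; suc)
open import Data.Nat.Combinatorics using (nCk+nC[k+1]≡[n+1]C[k+1]; nC1≡n)
open import Data.Nat.Tactic.RingSolver using (solve-∀)
open import Data.Product using (∃; _×_; _,_; proj₁)
open import Data.Rational using (ℚ; 0ℚ; 1ℚ; _+_; _-_; -_)
open import Data.Rational.Properties
  using (+-assoc; +-identityˡ; +-identityʳ; *-assoc; *-identityˡ; *-identityʳ; *-zeroˡ; *-zeroʳ; *-distribˡ-+; *-distribʳ-+)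
open import Data.Rational.Solver using (module +-*-Solver)
open import Data.Sum using (inj₁; inj₂)
open import Data.Unit using (tt)
open import Function using (_∘_)
open import Function.Bundles using (module Equivalence)
open import Relation.Binary.PropositionalEquality using (_≢_; refl; sym; trans; cong; cong₂; subst; module ≡-Reasoning)
open import Relation.Nullary using (¬_; does; yes; no)
open import Relation.Nullary.Decidable using (dec-true; dec-false)

open +-*-Solver
open ≡-Reasoning

private
  variable
    A B : Set

𝟙 : Bool → ℚ
𝟙 true  = 1ℚ
𝟙 false = 0ℚ

𝟙-∧ : (a b : Bool) → 𝟙 (a ∧ b) ≡ 𝟙 a * 𝟙 b
𝟙-∧ true  b = sym (*-identityˡ (𝟙 b))
𝟙-∧ false b = sym (*-zeroˡ (𝟙 b))

∑ : List A → (A → ℚ) → ℚ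
∑ xs f = sumℚ (map f xs)

∏ : List A → (A → ℚ) → ℚ
∏ xs f = prodℚ (map f xs)

infix 5 ∑ ∏
syntax ∑ xs (λ x → e) = ∑[ x ∈ xs ] e
syntax ∏ xs (λ x → e) = ∏[ x ∈ xs ] e

∑-cong : {f g : A → ℚ} (xs : List A) → (∀ {x} → x ∈ xs → f x ≡ g x) → ∑ xs f ≡ ∑ xs g
∑-cong xs f≡g = cong sumℚ (map-cong-local (All.tabulate f≡g))

∏-cong : {f g : A → ℚ} (xs : List A) → (∀ {x} → x ∈ xs → f x ≡ g x) → ∏ xs f ≡ ∏ xs g
∏-cong xs f≡g = cong prodℚ (map-cong-local (All.tabulate f≡g))

∑-++ : (xs ys : List A) (f : A → ℚ) → ∑ (xs ++ ys) f ≡ ∑ xs f + ∑ ys f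
∑-++ []       ys f = sym (+-identityˡ _)
∑-++ (x ∷ xs) ys f = trans (cong (f x +_) (∑-++ xs ys f)) (sym (+-assoc (f x) _ _))

∑-map : (g : A → B) (xs : List A) (f : B → ℚ) → ∑ (map g xs) f ≡ ∑[ x ∈ xs ] f (g x)
∑-map g []       f = refl
∑-map g (x ∷ xs) f = cong (f (g x) +_) (∑-map g xs f)

∑-0 : (xs : List A) → ∑[ x ∈ xs ] 0ℚ ≡ 0ℚ
∑-0 []       = refl
∑-0 (x ∷ xs) = trans (+-identityˡ _) (∑-0 xs)

∑-*ˡ : (c : ℚ) (xs : List A) (f : A → ℚ) → ∑[ x ∈ xs ] c * f x ≡ c * ∑ xs f
∑-*ˡ c []       f = sym (*-zeroʳ c)
∑-*ˡ c (x ∷ xs) f = trans (cong (c * f x +_) (∑-*ˡ c xs f)) (sym (*-distribˡ-+ c (f x) _))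

∑-*ʳ : (xs : List A) (f : A → ℚ) (c : ℚ) → ∑[ x ∈ xs ] f x * c ≡ ∑ xs f * c
∑-*ʳ []       f c = sym (*-zeroˡ c)
∑-*ʳ (x ∷ xs) f c = trans (cong (f x * c +_) (∑-*ʳ xs f c)) (sym (*-distribʳ-+ c (f x) _))

∑-+ : (xs : List A) (f g : A → ℚ) → ∑[ x ∈ xs ] (f x + g x) ≡ ∑ xs f + ∑ xs g
∑-+ []       f g = refl
∑-+ (x ∷ xs) f g = trans (cong (f x + g x +_) (∑-+ xs f g))
  (solve 4 (λ a b c d → a :+ b :+ (c :+ d) := (a :+ c) :+ (b :+ d)) refl (f x) (g x) (∑ xs f) (∑ xs g))

∑-comm : (xs : List A) (ys : List B) (f : A → B → ℚ) →
  ∑[ x ∈ xs ] ∑[ y ∈ ys ] f x y ≡ ∑[ y ∈ ys ] ∑[ x ∈ xs ] f x y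
∑-comm []       ys f = sym (∑-0 ys)
∑-comm (x ∷ xs) ys f = trans (cong (∑ ys (f x) +_) (∑-comm xs ys f)) (sym (∑-+ ys (f x) _))

∑-filter : (p : A → Bool) (xs : List A) (f : A → ℚ) →
  ∑ (filter (λ x → T? (p x)) xs) f ≡ ∑[ x ∈ xs ] 𝟙 (p x) * f x
∑-filter p []       f = refl
∑-filter p (x ∷ xs) f with p x
... | true  = cong₂ _+_ (sym (*-identityˡ (f x))) (∑-filter p xs f)
... | false = trans (∑-filter p xs f) (sym (trans (cong (_+ _) (*-zeroˡ (f x))) (+-identityˡ _)))

∑-𝟙-partition : (xs : List A) (a b : A → Bool) → (∀ x → a x ∧ b x ≡ false) → (f : A → ℚ) →
  ∑ xs f ≡ (∑[ x ∈ xs ] 𝟙 (not (a x) ∧ not (b x)) * f x) + ((∑[ x ∈ xs ] 𝟙 (a x) * f x) + (∑[ x ∈ xs ] 𝟙 (b x) * f x))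
∑-𝟙-partition xs a b a∧b≡false f =
  trans (∑-cong xs (λ {x} _ → 𝟙-split (a x) (b x) (a∧b≡false x) (f x)))
        (trans (∑-+ xs (λ x → 𝟙 (not (a x) ∧ not (b x)) * f x) (λ x → 𝟙 (a x) * f x + 𝟙 (b x) * f x))
               (cong (∑ xs (λ x → 𝟙 (not (a x) ∧ not (b x)) * f x) +_) (∑-+ xs (λ x → 𝟙 (a x) * f x) (λ x → 𝟙 (b x) * f x))))
  where
  𝟙-split : (a b : Bool) → a ∧ b ≡ false → (y : ℚ) → y ≡ 𝟙 (not a ∧ not b) * y + (𝟙 a * y + 𝟙 b * y)
  𝟙-split true  false _ y = solve 1 (λ y → y := con 0ℚ :* y :+ (con 1ℚ :* y :+ con 0ℚ :* y)) refl y
  𝟙-split false true  _ y = solve 1 (λ y → y := con 0ℚ :* y :+ (con 0ℚ :* y :+ con 1ℚ :* y)) refl y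
  𝟙-split false false _ y = solve 1 (λ y → y := con 1ℚ :* y :+ (con 0ℚ :* y :+ con 0ℚ :* y)) refl y

∏-*-𝟙-all : (xs : List A) (f : A → ℚ) (p : A → Bool) → ∏ xs f * 𝟙 (all p xs) ≡ ∏[ x ∈ xs ] f x * 𝟙 (p x)
∏-*-𝟙-all []       f p = refl
∏-*-𝟙-all (x ∷ xs) f p = begin
  f x * ∏ xs f * 𝟙 (p x ∧ all p xs)
    ≡⟨ cong (f x * ∏ xs f *_) (𝟙-∧ (p x) (all p xs)) ⟩
  f x * ∏ xs f * (𝟙 (p x) * 𝟙 (all p xs))
    ≡⟨ solve 4 (λ a b c d → a :* b :* (c :* d) := a :* c :* (b :* d)) refl (f x) (∏ xs f) (𝟙 (p x)) (𝟙 (all p xs)) ⟩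
  f x * 𝟙 (p x) * (∏ xs f * 𝟙 (all p xs))
    ≡⟨ cong (f x * 𝟙 (p x) *_) (∏-*-𝟙-all xs f p) ⟩
  f x * 𝟙 (p x) * (∏[ y ∈ xs ] f y * 𝟙 (p y)) ∎

∏-neg-𝟙-not : (xs : List A) (q : A → Bool) → ∏[ x ∈ xs ] - 𝟙 (not (q x)) ≡ -1ℚ ^ℚ length xs * 𝟙 (not (any q xs))
∏-neg-𝟙-not []       q = refl
∏-neg-𝟙-not (x ∷ xs) q with q x
... | true  = trans (cong (- 0ℚ *_) (∏-neg-𝟙-not xs q))
                    (solve 2 (λ s i → :- con 0ℚ :* (s :* i) := con -1ℚ :* s :* con 0ℚ) refl (-1ℚ ^ℚ length xs) (𝟙 (not (any q xs))))
... | false = trans (cong (- 1ℚ *_) (∏-neg-𝟙-not xs q))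
                    (solve 2 (λ s i → :- con 1ℚ :* (s :* i) := con -1ℚ :* s :* i) refl (-1ℚ ^ℚ length xs) (𝟙 (not (any q xs))))

all-cong : {p q : A → Bool} (xs : List A) → (∀ {x} → x ∈ xs → p x ≡ q x) → all p xs ≡ all q xs
all-cong xs p≡q = cong (foldr _∧_ true) (map-cong-local (All.tabulate p≡q))

all-false : (p : A → Bool) {x : A} (xs : List A) → x ∈ xs → p x ≡ false → all p xs ≡ false
all-false p (y ∷ xs) (here refl) px≡false = cong (_∧ all p xs) px≡false
all-false p (y ∷ xs) (there x∈xs) px≡false = trans (cong (p y ∧_) (all-false p xs x∈xs px≡false)) (∧-zeroʳ (p y))

T-ext : {a b : Bool} → (T a → T b) → (T b → T a) → a ≡ b
T-ext {true}  {true}  _   _   = refl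
T-ext {true}  {false} a⇒b _   = ⊥-elim (a⇒b tt)
T-ext {false} {true}  _   b⇒a = ⊥-elim (b⇒a tt)
T-ext {false} {false} _   _   = refl

T-not∨⁺ : {a b : Bool} → (T a → T b) → T (not a ∨ b)
T-not∨⁺ {true}  a⇒b = a⇒b tt
T-not∨⁺ {false} _   = tt

T-not∨⁻ : {a b : Bool} → T (not a ∨ b) → T a → T b
T-not∨⁻ {true} b _ = b

∈-map-∷-++⁻ : {x : A} {F : List A} (Fs : List (List A)) {Gs : List (List A)} →
  F ∈ map (x ∷_) Fs ++ Gs → (∃ λ F′ → F′ ∈ Fs × F ≡ x ∷ F′) ⊎ F ∈ Gs
∈-map-∷-++⁻ {x = x} Fs F∈ with ∈-++⁻ (map (x ∷_) Fs) F∈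
... | inj₁ F∈Fs = inj₁ (∈-map⁻ (x ∷_) F∈Fs)
... | inj₂ F∈Gs = inj₂ F∈Gs

∈-sublists⁻ : {F : List A} (xs : List A) → F ∈ sublists xs → F ⊆ xs
∈-sublists⁻ []       (here refl) = []
∈-sublists⁻ (x ∷ xs) F∈ with ∈-map-∷-++⁻ (sublists xs) F∈
... | inj₁ (F , F∈′ , refl) = refl ∷ ∈-sublists⁻ xs F∈′
... | inj₂ F∈′              = x ∷ʳ ∈-sublists⁻ xs F∈′

∈-choose⁻ : {F : List A} (k : ℕ) (xs : List A) → F ∈ choose k xs → F ⊆ xs × length F ≡ k
∈-choose⁻ zero    xs       (here refl) = minimum xs , refl
∈-choose⁻ (suc k) (x ∷ xs) F∈ with ∈-map-∷-++⁻ (choose k xs) F∈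
... | inj₁ (F , F∈′ , refl) = let F⊆ , ∣F∣ = ∈-choose⁻ k xs F∈′ in refl ∷ F⊆ , cong suc ∣F∣
... | inj₂ F∈′              = let F⊆ , ∣F∣ = ∈-choose⁻ (suc k) xs F∈′ in x ∷ʳ F⊆ , ∣F∣

∈-choose⁺ : {F xs : List A} → F ⊆ xs → F ∈ choose (length F) xs
∈-choose⁺ []                         = here refl
∈-choose⁺ {F = []}    (y ∷ʳ _)       = here refl
∈-choose⁺ {F = _ ∷ F} (y ∷ʳ F⊆)      = ∈-++⁺ʳ (map (y ∷_) (choose (length F) _)) (∈-choose⁺ F⊆)
∈-choose⁺             (refl ∷ F⊆)    = ∈-++⁺ˡ (∈-map⁺ _ (∈-choose⁺ F⊆))

length-choose : (k : ℕ) (xs : List A) → length (choose k xs) ≡ length xs C k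
length-choose zero    xs       = refl
length-choose (suc k) []       = refl
length-choose (suc k) (x ∷ xs) = begin
  length (map (x ∷_) (choose k xs) ++ choose (suc k) xs)
    ≡⟨ length-++ (map (x ∷_) (choose k xs)) ⟩
  length (map (x ∷_) (choose k xs)) ℕ.+ length (choose (suc k) xs)
    ≡⟨ cong₂ ℕ._+_ (trans (length-map (x ∷_) (choose k xs)) (length-choose k xs)) (length-choose (suc k) xs) ⟩
  length xs C k ℕ.+ length xs C suc k
    ≡⟨ nCk+nC[k+1]≡[n+1]C[k+1] (length xs) k ⟩
  suc (length xs) C suc k ∎

Unique-resp-⊇ : {F xs : List A} → F ⊆ xs → Unique xs → Unique F
Unique-resp-⊇ []          []            = []
Unique-resp-⊇ (_ ∷ʳ F⊆)   (_ ∷ uxs)     = Unique-resp-⊇ F⊆ uxs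
Unique-resp-⊇ (refl ∷ F⊆) (x∉xs ∷ uxs) = All-resp-⊆ F⊆ x∉xs ∷ Unique-resp-⊇ F⊆ uxs

Unique-choose : (k : ℕ) {xs : List A} → Unique xs → Unique (choose k xs)
Unique-choose zero    _                   = [] ∷ []
Unique-choose (suc k) {[]}     _          = []
Unique-choose (suc k) {x ∷ xs} u@(_ ∷ uxs) =
  Unique.++⁺ (Unique.map⁺ (λ { refl → refl }) (Unique-choose k uxs)) (Unique-choose (suc k) uxs) headless
  where
  headless : ∀ {F} → ¬ (F ∈ map (x ∷_) (choose k xs) × F ∈ choose (suc k) xs)
  headless (F∈ , F∈′) with ∈-map⁻ (x ∷_) F∈
  ... | _ , _ , refl = Unique.Unique[x∷xs]⇒x∉xs u (lookup (proj₁ (∈-choose⁻ (suc k) xs F∈′)) (here refl))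

∑-sublists-∷ : (x : A) (xs : List A) (f : List A → ℚ) →
  ∑ (sublists (x ∷ xs)) f ≡ (∑[ F ∈ sublists xs ] f (x ∷ F)) + ∑ (sublists xs) f
∑-sublists-∷ x xs f = trans (∑-++ (map (x ∷_) (sublists xs)) (sublists xs) f)
  (cong (_+ ∑ (sublists xs) f) (∑-map (x ∷_) (sublists xs) f))

∉-sublists : {x : A} {F : List A} (xs : List A) → x ∉ xs → F ∈ sublists xs → x ∉ F
∉-sublists xs x∉xs F∈ x∈F = x∉xs (lookup (∈-sublists⁻ xs F∈) x∈F)

∈-choose-mono : {S xs F : List A} (j : ℕ) → S ⊆ xs → F ∈ choose j S → F ∈ choose j xs
∈-choose-mono {S = S} {xs} {F} j S⊆xs F∈ =
  let F⊆S , ∣F∣≡j = ∈-choose⁻ j S F∈ in subst (λ i → F ∈ choose i xs) ∣F∣≡j (∈-choose⁺ (⊆-trans F⊆S S⊆xs))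

-- `choices (xs ∷ xss)` unfolds to `prependEach xs (choices xss)`.
prependEach : List A → List (List A) → List (List A)
prependEach ys r = foldr (λ y acc → map (y ∷_) r ++ acc) [] ys

∈-prependEach⁻ : {g : List A} (ys : List A) (r : List (List A)) → g ∈ prependEach ys r →
  ∃ λ y → ∃ λ g′ → y ∈ ys × g′ ∈ r × g ≡ y ∷ g′
∈-prependEach⁻ (y ∷ ys) r g∈ with ∈-map-∷-++⁻ r g∈
... | inj₁ (g′ , g′∈r , refl) = y , g′ , here refl , g′∈r , refl
... | inj₂ g∈′ =
  let y′ , g′ , y′∈ys , g′∈r , g≡ = ∈-prependEach⁻ ys r g∈′ in y′ , g′ , there y′∈ys , g′∈r , g≡

∑-prependEach : (ys : List A) (r : List (List A)) (f : List A → ℚ) →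
  ∑ (prependEach ys r) f ≡ ∑[ y ∈ ys ] ∑[ g ∈ r ] f (y ∷ g)
∑-prependEach []       r f = refl
∑-prependEach (y ∷ ys) r f = begin
  ∑ (map (y ∷_) r ++ prependEach ys r) f           ≡⟨ ∑-++ (map (y ∷_) r) (prependEach ys r) f ⟩
  ∑ (map (y ∷_) r) f + ∑ (prependEach ys r) f      ≡⟨ cong₂ _+_ (∑-map (y ∷_) r f) (∑-prependEach ys r f) ⟩
  (∑[ g ∈ r ] f (y ∷ g)) + (∑[ y′ ∈ ys ] ∑[ g ∈ r ] f (y′ ∷ g)) ∎

∈-choices⁻ : {g : List A} (xss : List (List A)) → g ∈ choices xss → ∀ {x} → x ∈ g → ∃ λ xs → xs ∈ xss × x ∈ xs
∈-choices⁻ []         (here refl) ()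
∈-choices⁻ (xs ∷ xss) g∈ x∈g with ∈-prependEach⁻ xs (choices xss) g∈
∈-choices⁻ (xs ∷ xss) g∈ (here refl)   | _ , _ , y∈xs , _ , refl = xs , here refl , y∈xs
∈-choices⁻ (xs ∷ xss) g∈ (there x∈g′) | _ , _ , _ , g′∈ , refl =
  let ys , ys∈xss , x∈ys = ∈-choices⁻ xss g′∈ x∈g′ in ys , there ys∈xss , x∈ys

∏-∑-distrib : (xss : List (List A)) (v : A → ℚ) → ∏[ xs ∈ xss ] ∑ xs v ≡ ∑[ g ∈ choices xss ] ∏ g v
∏-∑-distrib []         v = sym (+-identityʳ 1ℚ)
∏-∑-distrib (xs ∷ xss) v = begin
  ∑ xs v * (∏[ ys ∈ xss ] ∑ ys v)                   ≡⟨ cong (∑ xs v *_) (∏-∑-distrib xss v) ⟩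
  ∑ xs v * (∑[ g ∈ choices xss ] ∏ g v)              ≡⟨ ∑-*ʳ xs v _ ⟨
  ∑[ x ∈ xs ] v x * (∑[ g ∈ choices xss ] ∏ g v)      ≡⟨ ∑-cong xs (λ {x} _ → ∑-*ˡ (v x) (choices xss) (λ g → ∏ g v)) ⟨
  ∑[ x ∈ xs ] ∑[ g ∈ choices xss ] v x * ∏ g v        ≡⟨ ∑-prependEach xs (choices xss) (λ g → ∏ g v) ⟨
  ∑[ g ∈ choices (xs ∷ xss) ] ∏ g v ∎

-- Alternating sums over the subgraphs of a fixed edge set

module _ {n : ℕ} where

  ∈ᵇ-∷-≢ : {e f : Edge n} (E : EdgeSet n) → e ≢ f → (e ∈ᵇ (f ∷ E)) ≡ (e ∈ᵇ E)
  ∈ᵇ-∷-≢ {e} {f} E e≢f = cong (_∨ (e ∈ᵇ E)) (dec-false (≡-dec _≟ᶠ_ e f) e≢f)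

  ∈ᵇ-true : {e : Edge n} (E : EdgeSet n) → e ∈ E → (e ∈ᵇ E) ≡ true
  ∈ᵇ-true {e} (f ∷ E) (here e≡f) = cong (_∨ (e ∈ᵇ E)) (dec-true (≡-dec _≟ᶠ_ e f) e≡f)
  ∈ᵇ-true {e} (f ∷ E) (there e∈E) with does (≡-dec _≟ᶠ_ e f)
  ... | true  = refl
  ... | false = ∈ᵇ-true E e∈E

  ∈ᵇ-false : {e : Edge n} (E : EdgeSet n) → e ∉ E → (e ∈ᵇ E) ≡ false
  ∈ᵇ-false []      _   = refl
  ∈ᵇ-false (f ∷ E) e∉E = trans (∈ᵇ-∷-≢ E (e∉E ∘ here)) (∈ᵇ-false E (e∉E ∘ there))

  ∈ᵇ⇒∈ : {e : Edge n} (E : EdgeSet n) → T (e ∈ᵇ E) → e ∈ E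
  ∈ᵇ⇒∈ {e} (f ∷ E) e∈ᵇ with ≡-dec _≟ᶠ_ e f
  ... | yes e≡f = here e≡f
  ... | no  _   = there (∈ᵇ⇒∈ E e∈ᵇ)

  ∈ᵇ-∷-fresh : {x c : Edge n} {xs : EdgeSet n} (F : EdgeSet n) → x ∉ xs → c ∈ xs → (c ∈ᵇ (x ∷ F)) ≡ (c ∈ᵇ F)
  ∈ᵇ-∷-fresh {x} {c} F x∉xs c∈xs = ∈ᵇ-∷-≢ {c} {x} F (λ { refl → x∉xs c∈xs })

  _⊆ᵇ_ : EdgeSet n → EdgeSet n → Bool
  F ⊆ᵇ G = all (_∈ᵇ G) F

  disjointᵇ : EdgeSet n → EdgeSet n → Bool
  disjointᵇ K G = all (λ e → not (e ∈ᵇ G)) K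

  signedIndicator : EdgeSet n → EdgeSet n → ℚ
  signedIndicator G F = -1ℚ ^ℚ length F * 𝟙 (F ⊆ᵇ G)

  signedIndicator-∷ : (G : EdgeSet n) (x : Edge n) (F : EdgeSet n) →
    signedIndicator G (x ∷ F) ≡ - 𝟙 (x ∈ᵇ G) * signedIndicator G F
  signedIndicator-∷ G x F with x ∈ᵇ G
  ... | true  = solve 2 (λ s i → (con -1ℚ :* s) :* i := :- con 1ℚ :* (s :* i)) refl (-1ℚ ^ℚ length F) (𝟙 (F ⊆ᵇ G))
  ... | false = solve 2 (λ s i → (con -1ℚ :* s) :* con 0ℚ := :- con 0ℚ :* (s :* i)) refl (-1ℚ ^ℚ length F) (𝟙 (F ⊆ᵇ G))

  ∑-signedIndicator : (G K : EdgeSet n) → ∑ (sublists K) (signedIndicator G) ≡ 𝟙 (disjointᵇ K G)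
  ∑-signedIndicator G []       = refl
  ∑-signedIndicator G (x ∷ xs) = begin
    ∑ (sublists (x ∷ xs)) (signedIndicator G)
      ≡⟨ ∑-sublists-∷ x xs (signedIndicator G) ⟩
    (∑[ F ∈ sublists xs ] signedIndicator G (x ∷ F)) + ∑ (sublists xs) (signedIndicator G)
      ≡⟨ cong (_+ ∑ (sublists xs) (signedIndicator G))
           (trans (∑-cong (sublists xs) (λ {F} _ → signedIndicator-∷ G x F))
                  (∑-*ˡ (- 𝟙 (x ∈ᵇ G)) (sublists xs) (signedIndicator G))) ⟩
    - 𝟙 (x ∈ᵇ G) * ∑ (sublists xs) (signedIndicator G) + ∑ (sublists xs) (signedIndicator G)
      ≡⟨ cong (λ s → - 𝟙 (x ∈ᵇ G) * s + s) (∑-signedIndicator G xs) ⟩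
    - 𝟙 (x ∈ᵇ G) * 𝟙 (disjointᵇ xs G) + 𝟙 (disjointᵇ xs G)
      ≡⟨ 𝟙-not-∧ (x ∈ᵇ G) (disjointᵇ xs G) ⟩
    𝟙 (not (x ∈ᵇ G) ∧ disjointᵇ xs G) ∎
    where
    𝟙-not-∧ : (b a : Bool) → - 𝟙 b * 𝟙 a + 𝟙 a ≡ 𝟙 (not b ∧ a)
    𝟙-not-∧ true  a = solve 1 (λ i → :- con 1ℚ :* i :+ i := con 0ℚ) refl (𝟙 a)
    𝟙-not-∧ false a = solve 1 (λ i → :- con 0ℚ :* i :+ i := i) refl (𝟙 a)

  ∑-sublists-disjoint : {K : EdgeSet n} (v : EdgeSet n → ℚ) (L : EdgeSet n) → (∀ {e} → e ∈ L → e ∈ K) →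
    ∑[ F ∈ sublists L ] 𝟙 (disjointᵇ K F) * v F ≡ v []
  ∑-sublists-disjoint {K} v [] _ = begin
    𝟙 (all (λ _ → true) K) * v [] + 0ℚ ≡⟨ +-identityʳ _ ⟩
    𝟙 (all (λ _ → true) K) * v []      ≡⟨ cong (λ b → 𝟙 b * v []) (all-true K) ⟩
    1ℚ * v []                          ≡⟨ *-identityˡ (v []) ⟩
    v [] ∎
    where
    all-true : (xs : EdgeSet n) → all (λ _ → true) xs ≡ true
    all-true []       = refl
    all-true (_ ∷ xs) = all-true xs
  ∑-sublists-disjoint {K} v (x ∷ xs) L⊆K = begin
    ∑ (sublists (x ∷ xs)) f
      ≡⟨ ∑-sublists-∷ x xs f ⟩
    (∑[ F ∈ sublists xs ] f (x ∷ F)) + ∑ (sublists xs) f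
      ≡⟨ cong₂ _+_ (trans (∑-cong (sublists xs) (λ {F} _ → x∷F-meets-K F)) (∑-0 (sublists xs)))
                   (∑-sublists-disjoint v xs (L⊆K ∘ there)) ⟩
    0ℚ + v []
      ≡⟨ +-identityˡ (v []) ⟩
    v [] ∎
    where
    f : EdgeSet n → ℚ
    f F = 𝟙 (disjointᵇ K F) * v F
    x∷F-meets-K : (F : EdgeSet n) → f (x ∷ F) ≡ 0ℚ
    x∷F-meets-K F = trans (cong (λ b → 𝟙 b * v (x ∷ F)) (all-false _ K (L⊆K (here refl)) (cong not (∈ᵇ-true (x ∷ F) (here refl)))))
                          (*-zeroˡ (v (x ∷ F)))

  ∑-sublists-⊇ : (v : EdgeSet n → ℚ) (L : EdgeSet n) → Unique L → ∑[ F ∈ sublists L ] 𝟙 (L ⊆ᵇ F) * v F ≡ v L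
  ∑-sublists-⊇ v []       _           = trans (+-identityʳ _) (*-identityˡ (v []))
  ∑-sublists-⊇ v (x ∷ xs) u@(_ ∷ uxs) = begin
    ∑ (sublists (x ∷ xs)) f
      ≡⟨ ∑-sublists-∷ x xs f ⟩
    (∑[ F ∈ sublists xs ] f (x ∷ F)) + ∑ (sublists xs) f
      ≡⟨ cong₂ _+_ (trans (∑-cong (sublists xs) (λ {F} _ → x∷F-term F)) (∑-sublists-⊇ (v ∘ (x ∷_)) xs uxs))
                   (trans (∑-cong (sublists xs) F-term) (∑-0 (sublists xs))) ⟩
    v (x ∷ xs) + 0ℚ
      ≡⟨ +-identityʳ _ ⟩
    v (x ∷ xs) ∎
    where
    x∉xs : x ∉ xs
    x∉xs = Unique.Unique[x∷xs]⇒x∉xs u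
    f : EdgeSet n → ℚ
    f F = 𝟙 ((x ∷ xs) ⊆ᵇ F) * v F
    x∷F-term : (F : EdgeSet n) → f (x ∷ F) ≡ 𝟙 (xs ⊆ᵇ F) * v (x ∷ F)
    x∷F-term F = cong (λ b → 𝟙 b * v (x ∷ F)) (cong₂ _∧_ (∈ᵇ-true (x ∷ F) (here refl)) (all-cong xs (∈ᵇ-∷-fresh F x∉xs)))
    F-term : ∀ {F} → F ∈ sublists xs → f F ≡ 0ℚ
    F-term {F} F∈ = trans (cong (λ b → 𝟙 (b ∧ xs ⊆ᵇ F) * v F) (∈ᵇ-false F (∉-sublists xs x∉xs F∈))) (*-zeroˡ (v F))

  full∧empty≡false : (K : EdgeSet n) → -1ℚ ^ℚ length K ≡ -1ℚ → (F : EdgeSet n) → K ⊆ᵇ F ∧ disjointᵇ K F ≡ false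
  full∧empty≡false []       ()
  full∧empty≡false (c ∷ cs) _ F with c ∈ᵇ F
  ... | true  = ∧-zeroʳ (cs ⊆ᵇ F)
  ... | false = refl

  ∑-signedIndicator-neither-full-nor-empty : (G K : EdgeSet n) → Unique K → -1ℚ ^ℚ length K ≡ -1ℚ →
    ∑ (filter (λ F → T? (not (K ⊆ᵇ F) ∧ not (disjointᵇ K F))) (sublists K)) (signedIndicator G)
      ≡ - 𝟙 (not (K ⊆ᵇ G ∨ disjointᵇ K G))
  ∑-signedIndicator-neither-full-nor-empty G K uK odd = begin
    ∑ (filter (λ F → T? (not (K ⊆ᵇ F) ∧ not (disjointᵇ K F))) (sublists K)) σ
      ≡⟨ ∑-filter (λ F → not (K ⊆ᵇ F) ∧ not (disjointᵇ K F)) (sublists K) σ ⟩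
    neither
      ≡⟨ solve 3 (λ a f e → a := (a :+ (f :+ e)) :- (f :+ e)) refl neither full empty ⟩
    (neither + (full + empty)) - (full + empty)
      ≡⟨ cong₂ (λ t f → t - (f + empty))
           (sym (∑-𝟙-partition (sublists K) (K ⊆ᵇ_) (disjointᵇ K) (full∧empty≡false K odd) σ)) (∑-sublists-⊇ σ K uK) ⟩
    ∑ (sublists K) σ - (σ K + empty)
      ≡⟨ cong₂ (λ t e → t - (-1ℚ ^ℚ length K * 𝟙 (K ⊆ᵇ G) + e))
           (∑-signedIndicator G K) (∑-sublists-disjoint σ K (λ e∈K → e∈K)) ⟩
    𝟙 (disjointᵇ K G) - (-1ℚ ^ℚ length K * 𝟙 (K ⊆ᵇ G) + 1ℚ)
      ≡⟨ cong (λ s → 𝟙 (disjointᵇ K G) - (s * 𝟙 (K ⊆ᵇ G) + 1ℚ)) odd ⟩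
    𝟙 (disjointᵇ K G) - (-1ℚ * 𝟙 (K ⊆ᵇ G) + 1ℚ)
      ≡⟨ 𝟙-neither (K ⊆ᵇ G) (disjointᵇ K G) (full∧empty≡false K odd G) ⟩
    - 𝟙 (not (K ⊆ᵇ G ∨ disjointᵇ K G)) ∎
    where
    σ : EdgeSet n → ℚ
    σ = signedIndicator G
    neither full empty : ℚ
    neither = ∑[ F ∈ sublists K ] 𝟙 (not (K ⊆ᵇ F) ∧ not (disjointᵇ K F)) * σ F
    full    = ∑[ F ∈ sublists K ] 𝟙 (K ⊆ᵇ F) * σ F
    empty   = ∑[ F ∈ sublists K ] 𝟙 (disjointᵇ K F) * σ F
    𝟙-neither : (a b : Bool) → a ∧ b ≡ false → 𝟙 b - (-1ℚ * 𝟙 a + 1ℚ) ≡ - 𝟙 (not (a ∨ b))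
    𝟙-neither true  false _ = refl
    𝟙-neither false true  _ = refl
    𝟙-neither false false _ = refl

  ∑-sublists-⊇-filter : (p : Edge n → Bool) (L : EdgeSet n) → Unique L →
    ∑[ G ∈ sublists L ] 𝟙 (all (λ e → not (p e) ∨ e ∈ᵇ G) L) * ½ ^ℚ length L
      ≡ ½ ^ℚ length (filter (λ e → T? (p e)) L)
  ∑-sublists-⊇-filter p []       _           = refl
  ∑-sublists-⊇-filter p (x ∷ xs) u@(_ ∷ uxs) = begin
    ∑ (sublists (x ∷ xs)) f
      ≡⟨ ∑-sublists-∷ x xs f ⟩
    (∑[ F ∈ sublists xs ] f (x ∷ F)) + ∑ (sublists xs) f
      ≡⟨ cong₂ _+_ (trans (∑-cong (sublists xs) (λ {F} _ → x∷F-term F)) (∑-*ˡ ½ (sublists xs) g))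
                   (trans (∑-cong (sublists xs) F-term) (∑-*ˡ (½ * 𝟙 (not (p x))) (sublists xs) g)) ⟩
    ½ * ∑ (sublists xs) g + ½ * 𝟙 (not (p x)) * ∑ (sublists xs) g
      ≡⟨ cong (λ r → ½ * r + ½ * 𝟙 (not (p x)) * r) (∑-sublists-⊇-filter p xs uxs) ⟩
    ½ * r + ½ * 𝟙 (not (p x)) * r
      ≡⟨ halve-unless-p ⟩
    ½ ^ℚ length (filter (λ e → T? (p e)) (x ∷ xs)) ∎
    where
    x∉xs : x ∉ xs
    x∉xs = Unique.Unique[x∷xs]⇒x∉xs u
    h r : ℚ
    h = ½ ^ℚ length xs
    r = ½ ^ℚ length (filter (λ e → T? (p e)) xs)
    Q : EdgeSet n → Bool
    Q G = all (λ e → not (p e) ∨ e ∈ᵇ G) xs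
    f g : EdgeSet n → ℚ
    f G = 𝟙 ((not (p x) ∨ x ∈ᵇ G) ∧ Q G) * (½ * h)
    g G = 𝟙 (Q G) * h
    x∷F-term : (F : EdgeSet n) → f (x ∷ F) ≡ ½ * g F
    x∷F-term F = trans (cong (λ b → 𝟙 b * (½ * h)) (cong₂ _∧_ x-covered Q[x∷F]≡Q[F]))
                       (solve 3 (λ i a b → i :* (a :* b) := a :* (i :* b)) refl (𝟙 (Q F)) ½ h)
      where
      x-covered : not (p x) ∨ x ∈ᵇ (x ∷ F) ≡ true
      x-covered = trans (cong (not (p x) ∨_) (∈ᵇ-true (x ∷ F) (here refl))) (∨-zeroʳ (not (p x)))
      Q[x∷F]≡Q[F] : Q (x ∷ F) ≡ Q F
      Q[x∷F]≡Q[F] = all-cong xs (λ {c} c∈xs → cong (not (p c) ∨_) (∈ᵇ-∷-fresh F x∉xs c∈xs))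
    F-term : ∀ {F} → F ∈ sublists xs → f F ≡ ½ * 𝟙 (not (p x)) * g F
    F-term {F} F∈ = begin
      𝟙 ((not (p x) ∨ x ∈ᵇ F) ∧ Q F) * (½ * h)
        ≡⟨ cong (λ b → 𝟙 ((not (p x) ∨ b) ∧ Q F) * (½ * h)) (∈ᵇ-false F (∉-sublists xs x∉xs F∈)) ⟩
      𝟙 ((not (p x) ∨ false) ∧ Q F) * (½ * h)
        ≡⟨ cong (λ b → 𝟙 (b ∧ Q F) * (½ * h)) (∨-identityʳ (not (p x))) ⟩
      𝟙 (not (p x) ∧ Q F) * (½ * h)
        ≡⟨ cong (_* (½ * h)) (𝟙-∧ (not (p x)) (Q F)) ⟩
      𝟙 (not (p x)) * 𝟙 (Q F) * (½ * h)
        ≡⟨ solve 4 (λ a i b c → a :* i :* (b :* c) := b :* a :* (i :* c)) refl (𝟙 (not (p x))) (𝟙 (Q F)) ½ h ⟩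
      ½ * 𝟙 (not (p x)) * g F ∎
    halve-unless-p : ½ * r + ½ * 𝟙 (not (p x)) * r ≡ ½ ^ℚ length (filter (λ e → T? (p e)) (x ∷ xs))
    halve-unless-p with p x
    ... | true  = solve 1 (λ r → con ½ :* r :+ con ½ :* con 0ℚ :* r := con ½ :* r) refl r
    ... | false = solve 1 (λ r → con ½ :* r :+ con ½ :* con 1ℚ :* r := r) refl r

  all-⊆ᵇ≡all-covered⇒∈ᵇ : (g : List (EdgeSet n)) (N : EdgeSet n) → (∀ {E e} → E ∈ g → e ∈ E → e ∈ N) →
    (G : EdgeSet n) → all (_⊆ᵇ G) g ≡ all (λ e → not (any (e ∈ᵇ_) g) ∨ e ∈ᵇ G) N
  all-⊆ᵇ≡all-covered⇒∈ᵇ g N g⊆N G = T-ext to from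
    where
    to : T (all (_⊆ᵇ G) g) → T (all (λ e → not (any (e ∈ᵇ_) g) ∨ e ∈ᵇ G) N)
    to g⊆G = all⁻ (λ e → not (any (e ∈ᵇ_) g) ∨ e ∈ᵇ G) {N} (All.tabulate λ {e} _ → T-not∨⁺ λ e-covered →
      let E , E∈g , e∈ᵇE = find (any⁻ (e ∈ᵇ_) g e-covered)
      in All.lookup (all⁺ (_∈ᵇ G) E (All.lookup (all⁺ (_⊆ᵇ G) g g⊆G) E∈g)) (∈ᵇ⇒∈ {e} E e∈ᵇE))
    from : T (all (λ e → not (any (e ∈ᵇ_) g) ∨ e ∈ᵇ G) N) → T (all (_⊆ᵇ G) g)
    from N⊆G = all⁻ (_⊆ᵇ G) (All.tabulate λ {E} E∈g → all⁻ (_∈ᵇ G) (All.tabulate λ {e} e∈E →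
      T-not∨⁻ (All.lookup (all⁺ (λ e → not (any (e ∈ᵇ_) g) ∨ e ∈ᵇ G) N N⊆G) (g⊆N E∈g e∈E))
              (any⁺ (e ∈ᵇ_) (lose E∈g (Equivalence.from T-≡ (∈ᵇ-true E e∈E))))))

-- The sign (-1)^{binom(k,2)}

^ℚ-distribˡ-+-* : (q : ℚ) (a b : ℕ) → q ^ℚ (a ℕ.+ b) ≡ q ^ℚ a * q ^ℚ b
^ℚ-distribˡ-+-* q zero    b = sym (*-identityˡ _)
^ℚ-distribˡ-+-* q (suc a) b = trans (cong (q *_) (^ℚ-distribˡ-+-* q a b)) (sym (*-assoc q _ _))

-1^m*-1^m≡1 : (m : ℕ) → -1ℚ ^ℚ m * -1ℚ ^ℚ m ≡ 1ℚ
-1^m*-1^m≡1 zero    = refl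
-1^m*-1^m≡1 (suc m) = trans (solve 1 (λ s → con -1ℚ :* s :* (con -1ℚ :* s) := s :* s) refl (-1ℚ ^ℚ m)) (-1^m*-1^m≡1 m)

-1^[m+m+r]≡-1^r : (m r : ℕ) → -1ℚ ^ℚ (m ℕ.+ m ℕ.+ r) ≡ -1ℚ ^ℚ r
-1^[m+m+r]≡-1^r m r = begin
  -1ℚ ^ℚ (m ℕ.+ m ℕ.+ r)                ≡⟨ ^ℚ-distribˡ-+-* -1ℚ (m ℕ.+ m) r ⟩
  -1ℚ ^ℚ (m ℕ.+ m) * -1ℚ ^ℚ r           ≡⟨ cong (_* -1ℚ ^ℚ r) (trans (^ℚ-distribˡ-+-* -1ℚ m m) (-1^m*-1^m≡1 m)) ⟩
  1ℚ * -1ℚ ^ℚ r                         ≡⟨ *-identityˡ _ ⟩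
  -1ℚ ^ℚ r ∎

[1+m]C2≡m+mC2 : (m : ℕ) → suc m C 2 ≡ m ℕ.+ m C 2
[1+m]C2≡m+mC2 m = trans (sym (nCk+nC[k+1]≡[n+1]C[k+1] m 1)) (cong (ℕ._+ m C 2) (nC1≡n m))

-1^[kC2]≡-1 : (k : ℕ) → k % 4 ≡ 2 ⊎ k % 4 ≡ 3 → -1ℚ ^ℚ (k C 2) ≡ -1ℚ
-1^[kC2]≡-1 0 (inj₁ ())
-1^[kC2]≡-1 0 (inj₂ ())
-1^[kC2]≡-1 1 (inj₁ ())
-1^[kC2]≡-1 1 (inj₂ ())
-1^[kC2]≡-1 2 _ = refl
-1^[kC2]≡-1 3 _ = refl
-1^[kC2]≡-1 (suc (suc (suc (suc k)))) k≡2,3 = begin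
  -1ℚ ^ℚ ((4 ℕ.+ k) C 2)                                  ≡⟨ cong (-1ℚ ^ℚ_) [4+k]C2 ⟩
  -1ℚ ^ℚ ((3 ℕ.+ 2 ℕ.* k) ℕ.+ (3 ℕ.+ 2 ℕ.* k) ℕ.+ k C 2) ≡⟨ -1^[m+m+r]≡-1^r (3 ℕ.+ 2 ℕ.* k) (k C 2) ⟩
  -1ℚ ^ℚ (k C 2)                                          ≡⟨ -1^[kC2]≡-1 k k≡2,3 ⟩
  -1ℚ ∎
  where
  [4+k]C2 : (4 ℕ.+ k) C 2 ≡ (3 ℕ.+ 2 ℕ.* k) ℕ.+ (3 ℕ.+ 2 ℕ.* k) ℕ.+ k C 2
  [4+k]C2 = begin
    (4 ℕ.+ k) C 2
      ≡⟨ [1+m]C2≡m+mC2 (3 ℕ.+ k) ⟩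
    (3 ℕ.+ k) ℕ.+ (3 ℕ.+ k) C 2
      ≡⟨ cong ((3 ℕ.+ k) ℕ.+_) ([1+m]C2≡m+mC2 (2 ℕ.+ k)) ⟩
    (3 ℕ.+ k) ℕ.+ ((2 ℕ.+ k) ℕ.+ (2 ℕ.+ k) C 2)
      ≡⟨ cong (λ c → (3 ℕ.+ k) ℕ.+ ((2 ℕ.+ k) ℕ.+ c)) ([1+m]C2≡m+mC2 (1 ℕ.+ k)) ⟩
    (3 ℕ.+ k) ℕ.+ ((2 ℕ.+ k) ℕ.+ ((1 ℕ.+ k) ℕ.+ (1 ℕ.+ k) C 2))
      ≡⟨ cong (λ c → (3 ℕ.+ k) ℕ.+ ((2 ℕ.+ k) ℕ.+ ((1 ℕ.+ k) ℕ.+ c))) ([1+m]C2≡m+mC2 k) ⟩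
    (3 ℕ.+ k) ℕ.+ ((2 ℕ.+ k) ℕ.+ ((1 ℕ.+ k) ℕ.+ (k ℕ.+ k C 2)))
      ≡⟨ regroup k (k C 2) ⟩
    (3 ℕ.+ 2 ℕ.* k) ℕ.+ (3 ℕ.+ 2 ℕ.* k) ℕ.+ k C 2 ∎
    where
    regroup : ∀ k c → (3 ℕ.+ k) ℕ.+ ((2 ℕ.+ k) ℕ.+ ((1 ℕ.+ k) ℕ.+ (k ℕ.+ c)))
                    ≡ (3 ℕ.+ 2 ℕ.* k) ℕ.+ (3 ℕ.+ 2 ℕ.* k) ℕ.+ c
    regroup = solve-∀

-- Expanding P_{n,k}(1/2) over the random graph

∈-admissible⁻ : {n : ℕ} {S : List (Fin n)} {E : EdgeSet n} → E ∈ admissible S → E ⊆ choose 2 S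
∈-admissible⁻ {S = S} E∈ = ∈-sublists⁻ (choose 2 S) (proj₁ (∈-filter⁻ (λ E → T? (not (isClique E S) ∧ not (isIndep E S))) E∈))

assignment-edges∈allEdges : (n k : ℕ) {g : List (EdgeSet n)} → g ∈ assignments n k →
  ∀ {E e} → E ∈ g → e ∈ E → e ∈ allEdges n
assignment-edges∈allEdges n k g∈ E∈g e∈E with ∈-choices⁻ (map admissible (kSubsets n k)) g∈ E∈g
... | Es , Es∈ , E∈Es with ∈-map⁻ admissible Es∈
... | S , S∈ , refl = ∈-choose-mono 2 (proj₁ (∈-choose⁻ k (allFin n) S∈)) (lookup (∈-admissible⁻ {S = S} E∈Es) e∈E)

½^numEdges≡∑-graphs-containing : (n k : ℕ) {g : List (EdgeSet n)} → g ∈ assignments n k →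
  ½ ^ℚ numEdges g ≡ ∑[ G ∈ allGraphs n ] 𝟙 (all (_⊆ᵇ G) g) * ½ ^ℚ length (allEdges n)
½^numEdges≡∑-graphs-containing n k {g} g∈ = sym (trans
  (∑-cong (allGraphs n) λ {G} _ →
    cong (λ b → 𝟙 b * ½ ^ℚ length (allEdges n)) (all-⊆ᵇ≡all-covered⇒∈ᵇ g (allEdges n) (assignment-edges∈allEdges n k g∈) G))
  (∑-sublists-⊇-filter (λ e → any (e ∈ᵇ_) g) (allEdges n) (Unique-choose 2 (Unique.allFin⁺ n))))

P-½≡∑-graphs : (n k : ℕ) → P n k ½ ≡
  ∑[ G ∈ allGraphs n ] ½ ^ℚ length (allEdges n) * (∏[ S ∈ kSubsets n k ] ∑ (admissible S) (signedIndicator G))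
P-½≡∑-graphs n k = begin
  ∑[ g ∈ 𝒜 ] sign g * ½ ^ℚ numEdges g
    ≡⟨ ∑-cong 𝒜 (λ {g} g∈ → cong (sign g *_) (½^numEdges≡∑-graphs-containing n k g∈)) ⟩
  ∑[ g ∈ 𝒜 ] sign g * (∑[ G ∈ 𝒢 ] 𝟙 (all (_⊆ᵇ G) g) * h)
    ≡⟨ ∑-cong 𝒜 (λ {g} _ → trans (sym (∑-*ˡ (sign g) 𝒢 _)) (∑-cong 𝒢 (λ {G} _ → sign-*-𝟙-⊆ᵇ g G))) ⟩
  ∑[ g ∈ 𝒜 ] ∑[ G ∈ 𝒢 ] h * ∏ g (signedIndicator G)
    ≡⟨ ∑-comm 𝒜 𝒢 _ ⟩
  ∑[ G ∈ 𝒢 ] ∑[ g ∈ 𝒜 ] h * ∏ g (signedIndicator G)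
    ≡⟨ ∑-cong 𝒢 (λ {G} _ → ∑-*ˡ h 𝒜 _) ⟩
  ∑[ G ∈ 𝒢 ] h * (∑[ g ∈ 𝒜 ] ∏ g (signedIndicator G))
    ≡⟨ ∑-cong 𝒢 (λ {G} _ → cong (h *_) (∏-∑-distrib (map admissible 𝒮) (signedIndicator G))) ⟨
  ∑[ G ∈ 𝒢 ] h * (∏[ Es ∈ map admissible 𝒮 ] ∑ Es (signedIndicator G))
    ≡⟨ ∑-cong 𝒢 (λ {G} _ → cong (λ xs → h * prodℚ xs) (map-∘ 𝒮)) ⟨
  ∑[ G ∈ 𝒢 ] h * (∏[ S ∈ 𝒮 ] ∑ (admissible S) (signedIndicator G)) ∎
  where
  𝒜 = assignments n k
  𝒢 = allGraphs n
  𝒮 = kSubsets n k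
  h = ½ ^ℚ length (allEdges n)
  sign-*-𝟙-⊆ᵇ : (g : List (EdgeSet n)) (G : EdgeSet n) → sign g * (𝟙 (all (_⊆ᵇ G) g) * h) ≡ h * ∏ g (signedIndicator G)
  sign-*-𝟙-⊆ᵇ g G = trans (solve 3 (λ s i h → s :* (i :* h) := h :* (s :* i)) refl (sign g) (𝟙 (all (_⊆ᵇ G) g)) h)
                          (cong (h *_) (∏-*-𝟙-all g (λ E → -1ℚ ^ℚ length E) (_⊆ᵇ G)))

-- `isClique G S` and `isIndep G S` unfold to `choose 2 S ⊆ᵇ G` and `disjointᵇ (choose 2 S) G`.
∑-admissible : {n k : ℕ} → k % 4 ≡ 2 ⊎ k % 4 ≡ 3 → (G : EdgeSet n) {S : List (Fin n)} → S ∈ kSubsets n k →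
  ∑ (admissible S) (signedIndicator G) ≡ - 𝟙 (not (isClique G S ∨ isIndep G S))
∑-admissible {n} {k} k≡2,3 G {S} S∈ =
  let S⊆ , ∣S∣≡k = ∈-choose⁻ k (allFin n) S∈ in
  ∑-signedIndicator-neither-full-nor-empty G (choose 2 S)
    (Unique-choose 2 (Unique-resp-⊇ S⊆ (Unique.allFin⁺ n)))
    (trans (cong (-1ℚ ^ℚ_) (trans (length-choose 2 S) (cong (_C 2) ∣S∣≡k))) (-1^[kC2]≡-1 k k≡2,3))

ramseyProb≡∑-graphs : (n k : ℕ) → ramseyProb n k ≡ ∑[ G ∈ allGraphs n ] ½ ^ℚ length (allEdges n) * 𝟙 (isRamsey n k G)
ramseyProb≡∑-graphs n k = ∑-cong (allGraphs n) (λ {G} _ → if≡*𝟙 (isRamsey n k G))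
  where
  if≡*𝟙 : (b : Bool) → (if b then ½ ^ℚ length (allEdges n) else 0ℚ) ≡ ½ ^ℚ length (allEdges n) * 𝟙 b
  if≡*𝟙 true  = sym (*-identityʳ (½ ^ℚ length (allEdges n)))
  if≡*𝟙 false = sym (*-zeroʳ (½ ^ℚ length (allEdges n)))

length-kSubsets : (n k : ℕ) → length (kSubsets n k) ≡ n C k
length-kSubsets n k = trans (length-choose k (allFin n)) (cong (_C k) (length-tabulate {n = n} (λ i → i)))

∏-neg-𝟙-nonhomogeneous : (n k : ℕ) (G : EdgeSet n) →
  ∏[ S ∈ kSubsets n k ] - 𝟙 (not (isClique G S ∨ isIndep G S)) ≡ -1ℚ ^ℚ (n C k) * 𝟙 (isRamsey n k G)
∏-neg-𝟙-nonhomogeneous n k G = trans (∏-neg-𝟙-not (kSubsets n k) (λ S → isClique G S ∨ isIndep G S))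
  (cong (λ m → -1ℚ ^ℚ m * 𝟙 (isRamsey n k G)) (length-kSubsets n k))

theorem2p3 : (n k : ℕ) → 2 ≤ k → k ≤ n → (k % 4 ≡ 2 ⊎ k % 4 ≡ 3) →
    ramseyProb n k ≡ (-1ℚ ^ℚ (n C k)) * P n k ½
theorem2p3 n k _ _ k≡2,3 = begin
  ramseyProb n k
    ≡⟨ ramseyProb≡∑-graphs n k ⟩
  ∑[ G ∈ 𝒢 ] h * 𝟙 (isRamsey n k G)
    ≡⟨ ∑-cong 𝒢 (λ {G} _ → sign-cancels h (𝟙 (isRamsey n k G))) ⟩
  ∑[ G ∈ 𝒢 ] s * (h * (s * 𝟙 (isRamsey n k G)))
    ≡⟨ ∑-*ˡ s 𝒢 _ ⟩
  s * (∑[ G ∈ 𝒢 ] h * (s * 𝟙 (isRamsey n k G)))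
    ≡⟨ cong (s *_) (∑-cong 𝒢 (λ {G} _ → cong (h *_) (∏-neg-𝟙-nonhomogeneous n k G))) ⟨
  s * (∑[ G ∈ 𝒢 ] h * (∏[ S ∈ kSubsets n k ] - 𝟙 (not (isClique G S ∨ isIndep G S))))
    ≡⟨ cong (s *_) (∑-cong 𝒢 (λ {G} _ → cong (h *_) (∏-cong (kSubsets n k) (∑-admissible {n} {k} k≡2,3 G)))) ⟨
  s * (∑[ G ∈ 𝒢 ] h * (∏[ S ∈ kSubsets n k ] ∑ (admissible S) (signedIndicator G)))
    ≡⟨ cong (s *_) (P-½≡∑-graphs n k) ⟨
  s * P n k ½ ∎
  where
  𝒢 = allGraphs n
  h = ½ ^ℚ length (allEdges n)
  s = -1ℚ ^ℚ (n C k)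
  sign-cancels : ∀ x y → x * y ≡ s * (x * (s * y))
  sign-cancels x y = begin
    x * y               ≡⟨ *-identityˡ (x * y) ⟨
    1ℚ * (x * y)        ≡⟨ cong (_* (x * y)) (-1^m*-1^m≡1 (n C k)) ⟨
    s * s * (x * y)     ≡⟨ solve 3 (λ s x y → s :* s :* (x :* y) := s :* (x :* (s :* y))) refl s x y ⟩
    s * (x * (s * y)) ∎
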